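{- Let $r\geq 3$. If a graph $G$ of order $n$ contains a complete subgraph $K_{r+1}$ and has minimum degree \[ \delta(G)>\left(\frac{r-1}{r}-\frac{1}{r^{2}(r^{2}-1)}\right)n, \] then \[ js^{(2,r+1,2)}(G)>\frac{n^{r-1}}{r^{r+3}}. \]
   Context: All graphs are finite and simple; $\delta(G)$ is the minimum degree. For a graph $G$, $js^{(2,r+1,2)}(G)$ is the maximum, over all edges $uv$ of $G$, of the number of $(r+1)$-cliques of $G$ containing both $u$ and $v$ (and $0$ if $G$ has no edges). -}

module Defs where

open import Data.Nat using (ℕ; zero; suc; _+_; _*_; _∸_; _^_; _<_; _⊓_; _⊔_)
open import Data.Bool using (Bool; true; false; _∧_; _∨_; not; if_then_else_)
open import Data.Fin using (Fin; _≟_)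
open import Data.Fin.Subset using (Subset; ∣_∣)
open import Data.Vec using (Vec; []; _∷_; lookup)
open import Data.List using (List; []; _∷_; map; foldr; filter; length; concatMap; allFin; _++_)
open import Data.Product using (_×_; _,_; Σ)
open import Relation.Nullary.Decidable using (⌊_⌋)
open import Relation.Binary.PropositionalEquality using (_≡_)

record Graph (n : ℕ) : Set where
  field
    adj     : Fin n → Fin n → Bool
    irrefl  : ∀ i → adj i i ≡ false
    sym     : ∀ i j → adj i j ≡ adj j i
open Graph public

allL : ∀ {A : Set} → (A → Bool) → List A → Bool
allL p = foldr (λ x b → p x ∧ b) true

degree : ∀ {n} → Graph n → Fin n → ℕ
degree G v = length (filter (λ w → adj G v w Data.Bool.≟ true) (allFin _))

-- minimum degree δ(G) (0 for the empty graph on 0 vertices; for n ≥ 1 the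
-- initial value n exceeds every degree, so this is the true minimum)
minDegree : ∀ {n} → Graph n → ℕ
minDegree {n} G = foldr _⊓_ n (map (degree G) (allFin n))

allSubsets : (n : ℕ) → List (Subset n)
allSubsets zero = [] ∷ []
allSubsets (suc n) = map (true ∷_) (allSubsets n) ++ map (false ∷_) (allSubsets n)

isCompleteB : ∀ {n} → Graph n → Subset n → Bool
isCompleteB {n} G S =
  allL (λ i → allL (λ j →
    not (lookup S i ∧ lookup S j ∧ not ⌊ i ≟ j ⌋) ∨ adj G i j) (allFin n)) (allFin n)

isCliqueB : ∀ {n} → Graph n → ℕ → Subset n → Bool
isCliqueB G k S = isCompleteB G S ∧ ⌊ ∣ S ∣ Data.Nat.≟ k ⌋

ContainsK : ∀ {n} → Graph n → ℕ → Set
ContainsK {n} G k = Σ (Subset n) (λ S → isCliqueB G k S ≡ true)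

cliquesThrough : ∀ {n} → Graph n → ℕ → Fin n → Fin n → ℕ
cliquesThrough {n} G k u v =
  length (filter (λ S → (isCliqueB G k S ∧ lookup S u ∧ lookup S v) Data.Bool.≟ true)
                 (allSubsets n))

-- js^{(2,k,2)}(G): maximum over edges uv of the number of k-cliques
-- containing u and v; 0 if G has no edges
js2k2 : ∀ {n} → Graph n → ℕ → ℕ
js2k2 {n} G k =
  foldr _⊔_ 0
    (concatMap (λ u → map (λ v → if adj G u v then cliquesThrough G k u v else 0)
                          (allFin n))
               (allFin n))

{-# OPTIONS --safe #-}

-- Let K be the given (r + 1)-clique, δ = δ(G) and d_w the number of neighbours of w in K. Counting
-- ordered pairs of K-neighbours, Σ_w d_w(d_w − 1) is the sum of the codegrees of the ordered edges of
-- K; with Σ_w d_w ≥ (r + 1)δ and 2(r − 1)d ≤ d(d − 1) + r(r − 1) this yields an edge ab of K with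
-- many common neighbours, say c. Every vertex misses at most n − δ vertices, so choosing r − 1
-- vertices of N(a) ∩ N(b) greedily, each adjacent to all previous ones, gives at least
-- c(c − (n − δ))⋯(c − (r − 2)(n − δ)) / (r − 1)! cliques K_{r−1} there, and each of them spans a
-- K_{r+1} with a and b. The degree hypothesis bounds every factor below by a multiple of n, and the
-- product then exceeds (r − 1)!·n^{r−1}/r^{r+3}.

module Submission where

open import Data.Bool using (Bool; true; false; _∧_; _∨_; not; if_then_else_)
import Data.Bool as Bool
open import Data.Bool.Properties using (∧-conicalˡ; ∧-conicalʳ; ∧-assoc; ∧-comm; T-≡)
open import Data.Fin using (Fin; zero; suc; _≟_)
open import Data.Fin.Subset using (Subset; ∣_∣; _∩_; ⊥)
open import Data.Fin.Subset.Properties using (∣⊥∣≡0; ∣p∣≤n)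
open import Data.List using (List; []; _∷_; map; foldr; filter; length; allFin; _++_; cartesianProduct)
import Data.List as List
open import Data.List.Extrema.Nat using (argmax; f[xs]≤f[argmax])
open import Data.List.Membership.Propositional using (_∈_)
open import Data.List.Membership.Propositional.Properties
  using (∈-allFin; ∈-map⁺; ∈-concat⁺′; ∈-cartesianProduct⁺)
open import Data.List.Properties using (map-++; map-∘)
import Data.List.Relation.Unary.All as All
open import Data.List.Relation.Unary.Any using (here; there)
open import Data.Nat
  using (ℕ; zero; suc; _+_; _*_; _∸_; _^_; _<_; _≤_; z≤n; s≤s; _⊓_; _⊔_; _!; NonZero; >-nonZero)
  renaming (_≟_ to _≟ℕ_)
open import Data.Nat.ListAction using () renaming (sum to sumᴸ)
open import Data.Nat.ListAction.Properties using () renaming (sum-++ to sumᴸ-++)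
open import Data.Nat.Properties hiding (_≟_)
open import Data.Nat.Tactic.RingSolver using (solve-∀)
open import Data.Product using (_×_; _,_; ∃; ∃₂; proj₁; proj₂; uncurry)
open import Data.Vec using ([]; _∷_; lookup; tabulate; _[_]≔_)
open import Data.Vec.Properties using (lookup∘tabulate; lookup-zipWith; lookup∘update; lookup∘update′; lookup-replicate)
open import Function using (_∘_)
open import Function.Bundles using (Equivalence)
open import Relation.Binary.PropositionalEquality
  using (_≡_; _≢_; refl; sym; trans; cong; cong₂; subst; module ≡-Reasoning)
open import Relation.Nullary using (yes; no; contradiction)
open import Relation.Nullary.Decidable using (⌊_⌋; toWitness; fromWitness)

open import Defs hiding (sym)

open import Algebra.Properties.CommutativeSemigroup *-commutativeSemigroup
  using () renaming (x∙yz≈y∙xz to x*[y*z]≡y*[x*z])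
open import Algebra.Properties.Semiring.Sum +-*-semiring
  using (sum; sum-syntax; ∑-distrib-+; ∑-comm; *-distribˡ-sum; *-distribʳ-sum; sum-replicate-zero)

-- Finite sums

𝟙 : Bool → ℕ
𝟙 true  = 1
𝟙 false = 0

𝟙≤1 : ∀ b → 𝟙 b ≤ 1
𝟙≤1 true  = ≤-refl
𝟙≤1 false = z≤n

sum-mono-≤ : ∀ {n} {f g : Fin n → ℕ} → (∀ i → f i ≤ g i) → sum f ≤ sum g
sum-mono-≤ {zero}  f≤g = z≤n
sum-mono-≤ {suc n} f≤g = +-mono-≤ (f≤g zero) (sum-mono-≤ (f≤g ∘ suc))

sum-cong : ∀ {n} {f g : Fin n → ℕ} → (∀ i → f i ≡ g i) → sum f ≡ sum g
sum-cong {zero}  f≡g = refl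
sum-cong {suc n} f≡g = cong₂ _+_ (f≡g zero) (sum-cong (f≡g ∘ suc))

sum-const : ∀ n c → ∑[ i < n ] c ≡ n * c
sum-const zero    c = refl
sum-const (suc n) c = cong (c +_) (sum-const n c)

sum-𝟙-≟ : ∀ {n} (a : Fin n) → ∑[ j < n ] 𝟙 ⌊ j ≟ a ⌋ ≡ 1
sum-𝟙-≟ {suc n} zero    = cong suc (sum-replicate-zero n)
sum-𝟙-≟ {suc n} (suc a) = trans (sum-cong 𝟙-≟-suc) (sum-𝟙-≟ a)
  where
  𝟙-≟-suc : ∀ j → 𝟙 ⌊ suc j ≟ suc a ⌋ ≡ 𝟙 ⌊ j ≟ a ⌋
  𝟙-≟-suc j with j ≟ a
  ... | yes _ = refl
  ... | no  _ = refl

sum-𝟙-≟-+ : ∀ {n} (a : Fin n) (g : Fin n → ℕ) → ∑[ j < n ] (𝟙 ⌊ j ≟ a ⌋ + g j) ≡ suc (sum g)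
sum-𝟙-≟-+ a g = trans (∑-distrib-+ (λ j → 𝟙 ⌊ j ≟ a ⌋) g) (cong (_+ sum g) (sum-𝟙-≟ a))

sum-pos⇒∃ : ∀ {n} (f : Fin n → ℕ) → 0 < sum f → ∃ λ i → 0 < f i
sum-pos⇒∃ {suc n} f 0<∑f with f zero in f₀
... | suc _ = zero , subst (0 <_) (sym f₀) (s≤s z≤n)
... | zero  with sum-pos⇒∃ (f ∘ suc) 0<∑f
...   | i , 0<fi = suc i , 0<fi

𝟙-*-≤ : ∀ b {c m} → 𝟙 b * c ≤ m → 𝟙 b * c ≤ 𝟙 b * m
𝟙-*-≤ true  c≤m = ≤-trans c≤m (≤-reflexive (sym (+-identityʳ _)))
𝟙-*-≤ false _   = z≤n

𝟙-not+𝟙 : ∀ b → 𝟙 (not b) + 𝟙 b ≡ 1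
𝟙-not+𝟙 true  = refl
𝟙-not+𝟙 false = refl

∣S∣≡sum : ∀ {n} (S : Subset n) → ∣ S ∣ ≡ ∑[ i < n ] 𝟙 (lookup S i)
∣S∣≡sum []          = refl
∣S∣≡sum (true  ∷ S) = cong suc (∣S∣≡sum S)
∣S∣≡sum (false ∷ S) = ∣S∣≡sum S

sumSubsets : ∀ {n} → (Subset n → ℕ) → ℕ
sumSubsets {zero}  f = f []
sumSubsets {suc n} f = sumSubsets (f ∘ (true ∷_)) + sumSubsets (f ∘ (false ∷_))

sumSubsets-cong : ∀ {n} {f g : Subset n → ℕ} → (∀ S → f S ≡ g S) → sumSubsets f ≡ sumSubsets g
sumSubsets-cong {zero}  f≡g = f≡g []
sumSubsets-cong {suc n} f≡g =
  cong₂ _+_ (sumSubsets-cong (f≡g ∘ (true ∷_))) (sumSubsets-cong (f≡g ∘ (false ∷_)))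

sumSubsets-mono-≤ : ∀ {n} {f g : Subset n → ℕ} → (∀ S → f S ≤ g S) → sumSubsets f ≤ sumSubsets g
sumSubsets-mono-≤ {zero}  f≤g = f≤g []
sumSubsets-mono-≤ {suc n} f≤g =
  +-mono-≤ (sumSubsets-mono-≤ (f≤g ∘ (true ∷_))) (sumSubsets-mono-≤ (f≤g ∘ (false ∷_)))

sumSubsets-*ʳ : ∀ {n} c (f : Subset n → ℕ) → sumSubsets (λ S → f S * c) ≡ sumSubsets f * c
sumSubsets-*ʳ {zero}  c f = refl
sumSubsets-*ʳ {suc n} c f =
  trans (cong₂ _+_ (sumSubsets-*ʳ c (f ∘ (true ∷_))) (sumSubsets-*ʳ c (f ∘ (false ∷_))))
        (sym (*-distribʳ-+ c (sumSubsets (f ∘ (true ∷_))) (sumSubsets (f ∘ (false ∷_)))))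

sumSubsets-comm-sum : ∀ {n m} (f : Subset n → Fin m → ℕ) →
                      sumSubsets (λ S → ∑[ i < m ] f S i) ≡ ∑[ i < m ] sumSubsets (λ S → f S i)
sumSubsets-comm-sum {zero}  f = refl
sumSubsets-comm-sum {suc n} f =
  trans (cong₂ _+_ (sumSubsets-comm-sum (f ∘ (true ∷_))) (sumSubsets-comm-sum (f ∘ (false ∷_))))
        (sym (∑-distrib-+ (λ i → sumSubsets (λ S → f (true ∷ S) i))
                          (λ i → sumSubsets (λ S → f (false ∷ S) i))))

term≤sumSubsets : ∀ {n} (f : Subset n → ℕ) S → f S ≤ sumSubsets f
term≤sumSubsets f []          = ≤-refl
term≤sumSubsets f (true  ∷ S) = ≤-trans (term≤sumSubsets (f ∘ (true ∷_)) S) (m≤m+n _ _)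
term≤sumSubsets f (false ∷ S) = ≤-trans (term≤sumSubsets (f ∘ (false ∷_)) S) (m≤n+m _ _)

-- Inserting y is a bijection from the subsets avoiding y onto those containing y.
sumSubsets-insert : ∀ {n} (y : Fin n) (f : Subset n → ℕ) →
                    sumSubsets (λ S → if lookup S y then f S else 0) ≡
                    sumSubsets (λ S → if lookup S y then 0 else f (S [ y ]≔ true))
sumSubsets-insert {suc n} zero    f = +-comm (sumSubsets (f ∘ (true ∷_))) (sumSubsets {n} (λ _ → 0))
sumSubsets-insert {suc n} (suc y) f =
  cong₂ _+_ (sumSubsets-insert y (f ∘ (true ∷_))) (sumSubsets-insert y (f ∘ (false ∷_)))

sumSubsets-𝟙-≤-insert : ∀ {n} (y : Fin n) (P Q : Subset n → Bool) →
                        (∀ S → P S ≡ true → lookup S y ≡ false × Q (S [ y ]≔ true) ≡ true) →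
                        sumSubsets (𝟙 ∘ P) ≤ sumSubsets (λ S → 𝟙 (Q S ∧ lookup S y))
sumSubsets-𝟙-≤-insert y P Q P⇒insert-Q = begin
  sumSubsets (𝟙 ∘ P)                                                   ≤⟨ sumSubsets-mono-≤ injects ⟩
  sumSubsets (λ S → if lookup S y then 0 else 𝟙 (Q (S [ y ]≔ true)))  ≡⟨ sumSubsets-insert y (𝟙 ∘ Q) ⟨
  sumSubsets (λ S → if lookup S y then 𝟙 (Q S) else 0)                ≡⟨ sumSubsets-cong as-∧ ⟩
  sumSubsets (λ S → 𝟙 (Q S ∧ lookup S y))                              ∎
  where
  open ≤-Reasoning
  injects : ∀ S → 𝟙 (P S) ≤ (if lookup S y then 0 else 𝟙 (Q (S [ y ]≔ true)))
  injects S with P S in PS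
  ... | false = z≤n
  ... | true  rewrite proj₁ (P⇒insert-Q S PS) | proj₂ (P⇒insert-Q S PS) = ≤-refl
  as-∧ : ∀ S → (if lookup S y then 𝟙 (Q S) else 0) ≡ 𝟙 (Q S ∧ lookup S y)
  as-∧ S with lookup S y | Q S
  ... | true  | true  = refl
  ... | true  | false = refl
  ... | false | true  = refl
  ... | false | false = refl

sumSubsets-incidences : ∀ {n} m (Q : Subset n → Bool) → (∀ S → Q S ≡ true → ∣ S ∣ ≡ m) →
                        ∑[ y < n ] sumSubsets (λ S → 𝟙 (Q S ∧ lookup S y)) ≡ sumSubsets (𝟙 ∘ Q) * m
sumSubsets-incidences {n} m Q size = begin
  ∑[ y < n ] sumSubsets (λ S → 𝟙 (Q S ∧ lookup S y))  ≡⟨ sumSubsets-comm-sum (λ S y → 𝟙 (Q S ∧ lookup S y)) ⟨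
  sumSubsets (λ S → ∑[ y < n ] 𝟙 (Q S ∧ lookup S y))  ≡⟨ sumSubsets-cong incidences ⟩
  sumSubsets (λ S → 𝟙 (Q S) * m)                      ≡⟨ sumSubsets-*ʳ m (𝟙 ∘ Q) ⟩
  sumSubsets (𝟙 ∘ Q) * m                              ∎
  where
  open ≡-Reasoning
  incidences : ∀ S → ∑[ y < n ] 𝟙 (Q S ∧ lookup S y) ≡ 𝟙 (Q S) * m
  incidences S with Q S in QS
  ... | false = sum-replicate-zero n
  ... | true  = trans (sym (∣S∣≡sum S)) (trans (size S QS) (sym (+-identityʳ m)))

sumᴸ-map-tabulate : ∀ {A : Set} {n} (f : A → ℕ) (g : Fin n → A) →
                    sumᴸ (map f (List.tabulate g)) ≡ ∑[ i < n ] f (g i)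
sumᴸ-map-tabulate {n = zero}  f g = refl
sumᴸ-map-tabulate {n = suc n} f g = cong (f (g zero) +_) (sumᴸ-map-tabulate f (g ∘ suc))

sumᴸ-map-allSubsets : ∀ {n} (f : Subset n → ℕ) → sumᴸ (map f (allSubsets n)) ≡ sumSubsets f
sumᴸ-map-allSubsets {zero}  f = +-identityʳ (f [])
sumᴸ-map-allSubsets {suc n} f = begin
  sumᴸ (map f (map (true ∷_) Ss ++ map (false ∷_) Ss))
    ≡⟨ cong sumᴸ (map-++ f (map (true ∷_) Ss) (map (false ∷_) Ss)) ⟩
  sumᴸ (map f (map (true ∷_) Ss) ++ map f (map (false ∷_) Ss))
    ≡⟨ sumᴸ-++ (map f (map (true ∷_) Ss)) (map f (map (false ∷_) Ss)) ⟩
  sumᴸ (map f (map (true ∷_) Ss)) + sumᴸ (map f (map (false ∷_) Ss))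
    ≡⟨ cong₂ (λ xs ys → sumᴸ xs + sumᴸ ys) (map-∘ {g = f} Ss) (map-∘ {g = f} Ss) ⟨
  sumᴸ (map (f ∘ (true ∷_)) Ss) + sumᴸ (map (f ∘ (false ∷_)) Ss)
    ≡⟨ cong₂ _+_ (sumᴸ-map-allSubsets (f ∘ (true ∷_))) (sumᴸ-map-allSubsets (f ∘ (false ∷_))) ⟩
  sumSubsets f
    ∎
  where
  open ≡-Reasoning
  Ss : List (Subset n)
  Ss = allSubsets n

length-filter-≡true : ∀ {A : Set} (p : A → Bool) xs →
                      length (filter (λ x → p x Bool.≟ true) xs) ≡ sumᴸ (map (𝟙 ∘ p) xs)
length-filter-≡true p []       = refl
length-filter-≡true p (x ∷ xs) with p x
... | true  = cong suc (length-filter-≡true p xs)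
... | false = length-filter-≡true p xs

-- Subsets as Boolean vectors

allL-tabulate⁻ : ∀ {A : Set} {n} (p : A → Bool) (g : Fin n → A) →
                 allL p (List.tabulate g) ≡ true → ∀ i → p (g i) ≡ true
allL-tabulate⁻ p g all zero    = ∧-conicalˡ _ _ all
allL-tabulate⁻ p g all (suc i) = allL-tabulate⁻ p (g ∘ suc) (∧-conicalʳ _ _ all) i

allL-tabulate⁺ : ∀ {A : Set} {n} (p : A → Bool) (g : Fin n → A) →
                 (∀ i → p (g i) ≡ true) → allL p (List.tabulate g) ≡ true
allL-tabulate⁺ {n = zero}  p g all = refl
allL-tabulate⁺ {n = suc n} p g all = cong₂ _∧_ (all zero) (allL-tabulate⁺ p (g ∘ suc) (all ∘ suc))

infix 4 _⊆_
infix 6.5 _⊆ᵇ_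

_⊆_ : ∀ {n} → Subset n → Subset n → Set
S ⊆ X = ∀ {i} → lookup S i ≡ true → lookup X i ≡ true

_⊆ᵇ_ : ∀ {n} → Subset n → Subset n → Bool
S ⊆ᵇ X = allL (λ i → not (lookup S i) ∨ lookup X i) (allFin _)

⊆ᵇ⇒⊆ : ∀ {n} (S X : Subset n) → S ⊆ᵇ X ≡ true → S ⊆ X
⊆ᵇ⇒⊆ S X S⊆ᵇX {i} i∈S = implication (allL-tabulate⁻ _ _ S⊆ᵇX i)
  where
  implication : (not (lookup S i) ∨ lookup X i) ≡ true → lookup X i ≡ true
  implication rewrite i∈S = λ i∈X → i∈X

⊆⇒⊆ᵇ : ∀ {n} (S X : Subset n) → S ⊆ X → S ⊆ᵇ X ≡ true
⊆⇒⊆ᵇ S X S⊆X = allL-tabulate⁺ _ _ implication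
  where
  implication : ∀ i → (not (lookup S i) ∨ lookup X i) ≡ true
  implication i with lookup S i in i∈S
  ... | false = refl
  ... | true  = S⊆X i∈S

⊆-∩⁻ : ∀ {n} (S X Y : Subset n) → S ⊆ X ∩ Y → S ⊆ X × S ⊆ Y
⊆-∩⁻ S X Y S⊆X∩Y = (λ {i} i∈S → ∧-conicalˡ _ _ (∈-∩ i i∈S)) ,
                    (λ {i} i∈S → ∧-conicalʳ _ _ (∈-∩ i i∈S))
  where
  ∈-∩ : ∀ i → lookup S i ≡ true → (lookup X i ∧ lookup Y i) ≡ true
  ∈-∩ i i∈S = trans (sym (lookup-zipWith _∧_ i X Y)) (S⊆X∩Y i∈S)

∣S[y]≔true∣ : ∀ {n} (S : Subset n) y → lookup S y ≡ false → ∣ S [ y ]≔ true ∣ ≡ suc ∣ S ∣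
∣S[y]≔true∣ (false ∷ S) zero    refl = refl
∣S[y]≔true∣ (true  ∷ S) (suc y) y∉S  = cong suc (∣S[y]≔true∣ S y y∉S)
∣S[y]≔true∣ (false ∷ S) (suc y) y∉S  = ∣S[y]≔true∣ S y y∉S

∈-insert⁻ : ∀ {n} (S : Subset n) {i y} → lookup (S [ y ]≔ true) i ≡ true → i ≢ y → lookup S i ≡ true
∈-insert⁻ S {i} {y} i∈ i≢y = trans (sym (lookup∘update′ i≢y S true)) i∈

∈-insert⁺ : ∀ {n} (S : Subset n) {i} y → lookup S i ≡ true → lookup (S [ y ]≔ true) i ≡ true
∈-insert⁺ S {i} y i∈S with i ≟ y
... | yes refl = lookup∘update i S true
... | no  i≢y  = trans (lookup∘update′ i≢y S true) i∈S

∉⊥ : ∀ {n} (i : Fin n) → lookup (⊥ {n}) i ≢ true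
∉⊥ i i∈⊥ with () ← trans (sym (lookup-replicate i false)) i∈⊥

-- Cliques, neighbourhoods and degrees

IsComplete : ∀ {n} → Graph n → Subset n → Set
IsComplete G S = ∀ {i j} → lookup S i ≡ true → lookup S j ≡ true → i ≢ j → adj G i j ≡ true

nbhd : ∀ {n} → Graph n → Fin n → Subset n
nbhd G y = tabulate (adj G y)

foldr-⊓-≤-∈ : ∀ {x} {xs : List ℕ} z → x ∈ xs → foldr _⊓_ z xs ≤ x
foldr-⊓-≤-∈ z (here refl)            = m⊓n≤m _ _
foldr-⊓-≤-∈ {xs = y ∷ _} z (there x∈) = ≤-trans (m⊓n≤n y _) (foldr-⊓-≤-∈ z x∈)

foldr-⊓-≤-init : ∀ z (xs : List ℕ) → foldr _⊓_ z xs ≤ z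
foldr-⊓-≤-init z []       = ≤-refl
foldr-⊓-≤-init z (x ∷ xs) = ≤-trans (m⊓n≤n x _) (foldr-⊓-≤-init z xs)

foldr-⊔-≥-∈ : ∀ {x} {xs : List ℕ} → x ∈ xs → x ≤ foldr _⊔_ 0 xs
foldr-⊔-≥-∈ (here refl)             = m≤m⊔n _ _
foldr-⊔-≥-∈ {xs = y ∷ _} (there x∈) = ≤-trans (foldr-⊔-≥-∈ x∈) (m≤n⊔m y _)

module _ {n} (G : Graph n) where

  lookup-nbhd : ∀ y i → lookup (nbhd G y) i ≡ adj G y i
  lookup-nbhd y = lookup∘tabulate (adj G y)

  isCompleteB⇒IsComplete : ∀ S → isCompleteB G S ≡ true → IsComplete G S
  isCompleteB⇒IsComplete S complete {i} {j} i∈S j∈S i≢j =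
    entry⇒adj (allL-tabulate⁻ _ _ (allL-tabulate⁻ _ _ complete i) j)
    where
    entry⇒adj : (not (lookup S i ∧ lookup S j ∧ not ⌊ i ≟ j ⌋) ∨ adj G i j) ≡ true → adj G i j ≡ true
    entry⇒adj rewrite i∈S | j∈S with i ≟ j
    ... | yes i≡j = contradiction i≡j i≢j
    ... | no  _   = λ ij → ij

  IsComplete⇒isCompleteB : ∀ S → IsComplete G S → isCompleteB G S ≡ true
  IsComplete⇒isCompleteB S complete = allL-tabulate⁺ _ _ (λ i → allL-tabulate⁺ _ _ (entry i))
    where
    entry : ∀ i j → (not (lookup S i ∧ lookup S j ∧ not ⌊ i ≟ j ⌋) ∨ adj G i j) ≡ true
    entry i j with lookup S i in i∈S | lookup S j in j∈S | i ≟ j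
    ... | false | _     | _        = refl
    ... | true  | false | _        = refl
    ... | true  | true  | yes _    = refl
    ... | true  | true  | no  i≢j  = complete i∈S j∈S i≢j

  isCliqueB⁻ : ∀ {k} S → isCliqueB G k S ≡ true → IsComplete G S × ∣ S ∣ ≡ k
  isCliqueB⁻ {k} S clique =
    isCompleteB⇒IsComplete S (∧-conicalˡ _ _ clique) ,
    toWitness {a? = ∣ S ∣ ≟ℕ k} (Equivalence.from T-≡ (∧-conicalʳ _ _ clique))

  isCliqueB⁺ : ∀ {k} S → IsComplete G S → ∣ S ∣ ≡ k → isCliqueB G k S ≡ true
  isCliqueB⁺ {k} S complete size =
    cong₂ _∧_ (IsComplete⇒isCompleteB S complete) (Equivalence.to T-≡ (fromWitness {a? = ∣ S ∣ ≟ℕ k} size))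

  ⊆-nbhd⇒adj : ∀ y S {i} → S ⊆ nbhd G y → lookup S i ≡ true → adj G y i ≡ true
  ⊆-nbhd⇒adj y S {i} S⊆Ny i∈S = trans (sym (lookup-nbhd y i)) (S⊆Ny i∈S)

  ⊆-nbhd⇒∉ : ∀ y S → S ⊆ nbhd G y → lookup S y ≡ false
  ⊆-nbhd⇒∉ y S S⊆Ny with lookup S y in y∈S
  ... | false = refl
  ... | true  with () ← trans (sym (irrefl G y)) (⊆-nbhd⇒adj y S S⊆Ny y∈S)

  isCliqueB-insert : ∀ {k} y S → isCliqueB G k S ≡ true → S ⊆ nbhd G y →
                     isCliqueB G (suc k) (S [ y ]≔ true) ≡ true
  isCliqueB-insert {k} y S clique S⊆Ny =
    isCliqueB⁺ (S [ y ]≔ true) complete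
               (trans (∣S[y]≔true∣ S y (⊆-nbhd⇒∉ y S S⊆Ny)) (cong suc (proj₂ (isCliqueB⁻ S clique))))
    where
    complete : IsComplete G (S [ y ]≔ true)
    complete {i} {j} i∈ j∈ i≢j with i ≟ y | j ≟ y
    ... | yes refl | yes refl = contradiction refl i≢j
    ... | yes refl | no  j≢y  = ⊆-nbhd⇒adj y S S⊆Ny (∈-insert⁻ S j∈ j≢y)
    ... | no  i≢y  | yes refl = trans (Graph.sym G i y) (⊆-nbhd⇒adj y S S⊆Ny (∈-insert⁻ S i∈ i≢y))
    ... | no  i≢y  | no  j≢y  = proj₁ (isCliqueB⁻ S clique) (∈-insert⁻ S i∈ i≢y) (∈-insert⁻ S j∈ j≢y) i≢j

  degree≡sum : ∀ v → degree G v ≡ ∑[ w < n ] 𝟙 (adj G v w)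
  degree≡sum v =
    trans (length-filter-≡true (adj G v) (allFin n)) (sumᴸ-map-tabulate (𝟙 ∘ adj G v) (λ w → w))

  minDegree≤degree : ∀ v → minDegree G ≤ degree G v
  minDegree≤degree v = foldr-⊓-≤-∈ n (∈-map⁺ (degree G) (∈-allFin v))

  minDegree≤n : minDegree G ≤ n
  minDegree≤n = foldr-⊓-≤-init n (map (degree G) (allFin n))

  nonNeighbours≤ : ∀ v → ∑[ w < n ] 𝟙 (not (adj G v w)) ≤ n ∸ minDegree G
  nonNeighbours≤ v = m+n≤o⇒m≤o∸n _ (begin
    ∑[ w < n ] 𝟙 (not (adj G v w)) + minDegree G
      ≤⟨ +-monoʳ-≤ _ (≤-trans (minDegree≤degree v) (≤-reflexive (degree≡sum v))) ⟩
    ∑[ w < n ] 𝟙 (not (adj G v w)) + ∑[ w < n ] 𝟙 (adj G v w)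
      ≡⟨ ∑-distrib-+ (λ w → 𝟙 (not (adj G v w))) (λ w → 𝟙 (adj G v w)) ⟨
    ∑[ w < n ] (𝟙 (not (adj G v w)) + 𝟙 (adj G v w))
      ≡⟨ sum-cong (λ w → 𝟙-not+𝟙 (adj G v w)) ⟩
    ∑[ w < n ] 1
      ≡⟨ trans (sum-const n 1) (*-identityʳ n) ⟩
    n ∎)
    where open ≤-Reasoning

  ∣X∣≤nonNeighbours+∣X∩nbhd∣ : ∀ X y → ∣ X ∣ ≤ (n ∸ minDegree G) + ∣ X ∩ nbhd G y ∣
  ∣X∣≤nonNeighbours+∣X∩nbhd∣ X y = begin
    ∣ X ∣                                                                    ≡⟨ ∣S∣≡sum X ⟩
    ∑[ i < n ] 𝟙 (lookup X i)                                                ≤⟨ sum-mono-≤ split ⟩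
    ∑[ i < n ] (𝟙 (not (adj G y i)) + 𝟙 (lookup (X ∩ nbhd G y) i))
      ≡⟨ ∑-distrib-+ (λ i → 𝟙 (not (adj G y i))) (λ i → 𝟙 (lookup (X ∩ nbhd G y) i)) ⟩
    ∑[ i < n ] 𝟙 (not (adj G y i)) + ∑[ i < n ] 𝟙 (lookup (X ∩ nbhd G y) i)
      ≤⟨ +-mono-≤ (nonNeighbours≤ y) (≤-reflexive (sym (∣S∣≡sum (X ∩ nbhd G y)))) ⟩
    (n ∸ minDegree G) + ∣ X ∩ nbhd G y ∣                                     ∎
    where
    open ≤-Reasoning
    split : ∀ i → 𝟙 (lookup X i) ≤ 𝟙 (not (adj G y i)) + 𝟙 (lookup (X ∩ nbhd G y) i)
    split i rewrite lookup-zipWith _∧_ i X (nbhd G y) | lookup-nbhd y i with lookup X i | adj G y i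
    ... | true  | true  = ≤-refl
    ... | true  | false = ≤-refl
    ... | false | _     = z≤n

  cliquesThrough≤js2k2 : ∀ k {u v} → adj G u v ≡ true → cliquesThrough G k u v ≤ js2k2 G k
  cliquesThrough≤js2k2 k {u} {v} u~v = foldr-⊔-≥-∈ (∈-concat⁺′ v∈row (∈-map⁺ row (∈-allFin u)))
    where
    row : Fin n → List ℕ
    row u = map (λ v → if adj G u v then cliquesThrough G k u v else 0) (allFin n)
    v∈row : cliquesThrough G k u v ∈ row u
    v∈row = subst (_∈ row u) (cong (λ b → if b then cliquesThrough G k u v else 0) u~v)
                  (∈-map⁺ (λ w → if adj G u w then cliquesThrough G k u w else 0) (∈-allFin v))

-- Counting cliques greedily

fallingBy : ℕ → ℕ → ℕ → ℕ
fallingBy d m zero    = 1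
fallingBy d m (suc k) = m * fallingBy d (m ∸ d) k

fallingBy-monoʳ-≤ : ∀ d k {m m′} → m ≤ m′ → fallingBy d m k ≤ fallingBy d m′ k
fallingBy-monoʳ-≤ d zero    m≤m′ = ≤-refl
fallingBy-monoʳ-≤ d (suc k) m≤m′ = *-mono-≤ m≤m′ (fallingBy-monoʳ-≤ d k (∸-monoˡ-≤ d m≤m′))

module _ {n} (G : Graph n) where

  cliquesWithin : ℕ → Subset n → ℕ
  cliquesWithin k X = sumSubsets (λ S → 𝟙 (isCliqueB G k S ∧ S ⊆ᵇ X))

  1≤cliquesWithin-0 : ∀ X → 1 ≤ cliquesWithin 0 X
  1≤cliquesWithin-0 X = subst (λ b → 𝟙 b ≤ cliquesWithin 0 X) empty-counted
                                (term≤sumSubsets (λ S → 𝟙 (isCliqueB G 0 S ∧ S ⊆ᵇ X)) ⊥)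
    where
    empty-counted : (isCliqueB G 0 ⊥ ∧ ⊥ ⊆ᵇ X) ≡ true
    empty-counted = cong₂ _∧_ (isCliqueB⁺ G ⊥ (λ {i} i∈⊥ _ _ → contradiction i∈⊥ (∉⊥ i)) (∣⊥∣≡0 n))
                              (⊆⇒⊆ᵇ ⊥ X (λ {i} i∈⊥ → contradiction i∈⊥ (∉⊥ i)))

  cliquesWithin-∩-nbhd-≤ : ∀ k X y → lookup X y ≡ true →
                           cliquesWithin k (X ∩ nbhd G y) ≤
                           sumSubsets (λ S → 𝟙 ((isCliqueB G (suc k) S ∧ S ⊆ᵇ X) ∧ lookup S y))
  cliquesWithin-∩-nbhd-≤ k X y y∈X = sumSubsets-𝟙-≤-insert y _ _ extend
    where
    extend : ∀ S → (isCliqueB G k S ∧ S ⊆ᵇ X ∩ nbhd G y) ≡ true →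
             lookup S y ≡ false × (isCliqueB G (suc k) (S [ y ]≔ true) ∧ (S [ y ]≔ true) ⊆ᵇ X) ≡ true
    extend S counted with ⊆-∩⁻ S X (nbhd G y) (⊆ᵇ⇒⊆ S (X ∩ nbhd G y) (∧-conicalʳ _ _ counted))
    ... | S⊆X , S⊆Ny =
      ⊆-nbhd⇒∉ G y S S⊆Ny ,
      cong₂ _∧_ (isCliqueB-insert G y S (∧-conicalˡ _ _ counted) S⊆Ny)
                (⊆⇒⊆ᵇ (S [ y ]≔ true) X inserted⊆X)
      where
      inserted⊆X : (S [ y ]≔ true) ⊆ X
      inserted⊆X {i} i∈ with i ≟ y
      ... | yes refl = y∈X
      ... | no  i≢y  = S⊆X (∈-insert⁻ S i∈ i≢y)

  ∑-cliquesWithin-∩-nbhd-≤ : ∀ k X →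
    ∑[ y < n ] (𝟙 (lookup X y) * cliquesWithin k (X ∩ nbhd G y)) ≤ cliquesWithin (suc k) X * suc k
  ∑-cliquesWithin-∩-nbhd-≤ k X = begin
    ∑[ y < n ] (𝟙 (lookup X y) * cliquesWithin k (X ∩ nbhd G y))  ≤⟨ sum-mono-≤ extend ⟩
    ∑[ y < n ] sumSubsets (λ S → 𝟙 (Q S ∧ lookup S y))         ≡⟨ sumSubsets-incidences (suc k) Q size ⟩
    cliquesWithin (suc k) X * suc k                             ∎
    where
    open ≤-Reasoning
    Q : Subset n → Bool
    Q S = isCliqueB G (suc k) S ∧ S ⊆ᵇ X
    size : ∀ S → Q S ≡ true → ∣ S ∣ ≡ suc k
    size S QS = proj₂ (isCliqueB⁻ G S (∧-conicalˡ _ _ QS))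
    extend : ∀ y → 𝟙 (lookup X y) * cliquesWithin k (X ∩ nbhd G y) ≤
                   sumSubsets (λ S → 𝟙 (Q S ∧ lookup S y))
    extend y with lookup X y in y∈X
    ... | false = z≤n
    ... | true  = ≤-trans (≤-reflexive (+-identityʳ _)) (cliquesWithin-∩-nbhd-≤ k X y y∈X)

  -- Greedy choice: each vertex y of X misses at most n − δ vertices, so X ∩ N(y) is still large.
  fallingBy-≤-cliquesWithin : ∀ k X → fallingBy (n ∸ minDegree G) ∣ X ∣ k ≤ k ! * cliquesWithin k X
  fallingBy-≤-cliquesWithin zero    X = ≤-trans (1≤cliquesWithin-0 X) (≤-reflexive (sym (+-identityʳ _)))
  fallingBy-≤-cliquesWithin (suc k) X = begin
    ∣ X ∣ * fallingBy D (∣ X ∣ ∸ D) k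
      ≡⟨ cong (_* fallingBy D (∣ X ∣ ∸ D) k) (∣S∣≡sum X) ⟩
    (∑[ y < n ] 𝟙 (lookup X y)) * fallingBy D (∣ X ∣ ∸ D) k
      ≡⟨ *-distribʳ-sum (fallingBy D (∣ X ∣ ∸ D) k) (λ y → 𝟙 (lookup X y)) ⟩
    ∑[ y < n ] (𝟙 (lookup X y) * fallingBy D (∣ X ∣ ∸ D) k)
      ≤⟨ sum-mono-≤ (λ y → *-monoʳ-≤ (𝟙 (lookup X y)) (restrict y)) ⟩
    ∑[ y < n ] (𝟙 (lookup X y) * (k ! * cliquesWithin k (X ∩ nbhd G y)))
      ≡⟨ sum-cong (λ y → x*[y*z]≡y*[x*z] (𝟙 (lookup X y)) (k !) _) ⟩
    ∑[ y < n ] (k ! * (𝟙 (lookup X y) * cliquesWithin k (X ∩ nbhd G y)))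
      ≡⟨ *-distribˡ-sum (k !) (λ y → 𝟙 (lookup X y) * cliquesWithin k (X ∩ nbhd G y)) ⟨
    k ! * (∑[ y < n ] (𝟙 (lookup X y) * cliquesWithin k (X ∩ nbhd G y)))
      ≤⟨ *-monoʳ-≤ (k !) (∑-cliquesWithin-∩-nbhd-≤ k X) ⟩
    k ! * (cliquesWithin (suc k) X * suc k)
      ≡⟨ cong (k ! *_) (*-comm (cliquesWithin (suc k) X) (suc k)) ⟩
    k ! * (suc k * cliquesWithin (suc k) X)
      ≡⟨ x*[y*z]≡y*[x*z] (k !) (suc k) (cliquesWithin (suc k) X) ⟩
    suc k * (k ! * cliquesWithin (suc k) X)
      ≡⟨ *-assoc (suc k) (k !) (cliquesWithin (suc k) X) ⟨
    suc k ! * cliquesWithin (suc k) X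
      ∎
    where
    open ≤-Reasoning
    D : ℕ
    D = n ∸ minDegree G
    restrict : ∀ y → fallingBy D (∣ X ∣ ∸ D) k ≤ k ! * cliquesWithin k (X ∩ nbhd G y)
    restrict y = ≤-trans (fallingBy-monoʳ-≤ D k (m≤n+o⇒m∸n≤o ∣ X ∣ D (∣X∣≤nonNeighbours+∣X∩nbhd∣ G X y)))
                         (fallingBy-≤-cliquesWithin k (X ∩ nbhd G y))

  cliquesWithin-∩-nbhd≤cliquesThrough : ∀ k {a b} → adj G a b ≡ true →
    cliquesWithin k (nbhd G a ∩ nbhd G b) ≤ cliquesThrough G (suc (suc k)) a b
  cliquesWithin-∩-nbhd≤cliquesThrough k {a} {b} a~b = begin
    cliquesWithin k (nbhd G a ∩ nbhd G b)
      ≤⟨ cliquesWithin-∩-nbhd-≤ k (nbhd G a) b (trans (lookup-nbhd G a b) a~b) ⟩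
    sumSubsets (λ S → 𝟙 ((isCliqueB G (suc k) S ∧ S ⊆ᵇ nbhd G a) ∧ lookup S b))
      ≤⟨ sumSubsets-𝟙-≤-insert a _ _ extend ⟩
    sumSubsets (λ S → 𝟙 ((isCliqueB G (suc (suc k)) S ∧ lookup S b) ∧ lookup S a))
      ≡⟨ sumSubsets-cong (λ S → cong 𝟙 (reorder (isCliqueB G (suc (suc k)) S) (lookup S b) (lookup S a))) ⟩
    sumSubsets (𝟙 ∘ through)
      ≡⟨ trans (length-filter-≡true through (allSubsets n)) (sumᴸ-map-allSubsets (𝟙 ∘ through)) ⟨
    cliquesThrough G (suc (suc k)) a b
      ∎
    where
    open ≤-Reasoning
    through : Subset n → Bool
    through S = isCliqueB G (suc (suc k)) S ∧ lookup S a ∧ lookup S b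
    reorder : ∀ x y z → ((x ∧ y) ∧ z) ≡ (x ∧ z ∧ y)
    reorder x y z = trans (∧-assoc x y z) (cong (x ∧_) (∧-comm y z))
    extend : ∀ S → ((isCliqueB G (suc k) S ∧ S ⊆ᵇ nbhd G a) ∧ lookup S b) ≡ true →
             lookup S a ≡ false × (isCliqueB G (suc (suc k)) (S [ a ]≔ true) ∧ lookup (S [ a ]≔ true) b) ≡ true
    extend S counted = ⊆-nbhd⇒∉ G a S S⊆Na ,
                       cong₂ _∧_ (isCliqueB-insert G a S (∧-conicalˡ _ _ clique∧⊆) S⊆Na)
                                 (∈-insert⁺ S a (∧-conicalʳ _ _ counted))
      where
      clique∧⊆ : (isCliqueB G (suc k) S ∧ S ⊆ᵇ nbhd G a) ≡ true
      clique∧⊆ = ∧-conicalˡ _ _ counted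
      S⊆Na : S ⊆ nbhd G a
      S⊆Na = ⊆ᵇ⇒⊆ S (nbhd G a) (∧-conicalʳ _ _ clique∧⊆)

  codegree : Fin n → Fin n → ℕ
  codegree a b = ∣ nbhd G a ∩ nbhd G b ∣

  codegree≡sum : ∀ a b → codegree a b ≡ ∑[ w < n ] 𝟙 (adj G a w ∧ adj G b w)
  codegree≡sum a b = trans (∣S∣≡sum (nbhd G a ∩ nbhd G b)) (sum-cong common)
    where
    common : ∀ w → 𝟙 (lookup (nbhd G a ∩ nbhd G b) w) ≡ 𝟙 (adj G a w ∧ adj G b w)
    common w = cong 𝟙 (trans (lookup-zipWith _∧_ w (nbhd G a) (nbhd G b))
                             (cong₂ _∧_ (lookup-nbhd G a w) (lookup-nbhd G b w)))

-- An edge of the clique with large codegree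

∃-maximum₂ : ∀ {n} (F : Fin n → Fin n → ℕ) → Fin n → ∃₂ λ a b → ∀ x y → F x y ≤ F a b
∃-maximum₂ {n} F v = proj₁ best , proj₂ best , λ x y →
  All.lookup (f[xs]≤f[argmax] (v , v) pairs) (∈-cartesianProduct⁺ (∈-allFin x) (∈-allFin y))
  where
  pairs : List (Fin n × Fin n)
  pairs = cartesianProduct (allFin n) (allFin n)
  best : Fin n × Fin n
  best = argmax (uncurry F) (v , v) pairs

-- (d − q)(d − q − 1) ≥ 0, rearranged.
quadratic-bound : ∀ d q → 2 * q * d ≤ d * (d ∸ 1) + suc q * q
quadratic-bound zero    q = ≤-trans (≤-reflexive (*-zeroʳ (2 * q))) z≤n
quadratic-bound (suc e) q with q ≤? e
... | yes q≤e with t , refl ← m≤n⇒∃[o]m+o≡n q≤e =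
  ≤-trans (m≤m+n _ (t * suc t)) (≤-reflexive (identity q t))
  where
  identity : ∀ q t → 2 * q * suc (q + t) + t * suc t ≡ suc (q + t) * (q + t) + suc q * q
  identity = solve-∀
... | no q≰e with t , refl ← m≤n⇒∃[o]m+o≡n (≰⇒> q≰e) =
  ≤-trans (m≤m+n _ (t * suc t)) (≤-reflexive (identity e t))
  where
  identity : ∀ e t → 2 * (suc e + t) * suc e + t * suc t ≡ suc e * e + suc (suc e + t) * (suc e + t)
  identity = solve-∀

module CodegreeInClique {n} (G : Graph n) (K : Subset n) (K-complete : IsComplete G K) where

  edgeIn : Fin n → Fin n → ℕ
  edgeIn a b = 𝟙 (lookup K a ∧ lookup K b ∧ adj G a b)

  pairs : ℕ
  pairs = ∑[ a < n ] ∑[ b < n ] edgeIn a b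

  codegreeSum : ℕ
  codegreeSum = ∑[ a < n ] ∑[ b < n ] (edgeIn a b * codegree G a b)

  nbrsInK : Fin n → ℕ
  nbrsInK w = ∑[ x < n ] 𝟙 (lookup K x ∧ adj G w x)

  ∣K∣*δ≤∑nbrsInK : ∣ K ∣ * minDegree G ≤ ∑[ w < n ] nbrsInK w
  ∣K∣*δ≤∑nbrsInK = begin
    ∣ K ∣ * minDegree G
      ≡⟨ cong (_* minDegree G) (∣S∣≡sum K) ⟩
    (∑[ x < n ] 𝟙 (lookup K x)) * minDegree G
      ≡⟨ *-distribʳ-sum (minDegree G) (λ x → 𝟙 (lookup K x)) ⟩
    ∑[ x < n ] (𝟙 (lookup K x) * minDegree G)
      ≤⟨ sum-mono-≤ (λ x → *-monoʳ-≤ (𝟙 (lookup K x)) (minDegree≤degree G x)) ⟩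
    ∑[ x < n ] (𝟙 (lookup K x) * degree G x)
      ≡⟨ sum-cong degree-from-K ⟩
    ∑[ x < n ] ∑[ w < n ] 𝟙 (lookup K x ∧ adj G w x)
      ≡⟨ ∑-comm (λ x w → 𝟙 (lookup K x ∧ adj G w x)) ⟩
    ∑[ w < n ] nbrsInK w
      ∎
    where
    open ≤-Reasoning
    degree-from-K : ∀ x → 𝟙 (lookup K x) * degree G x ≡ ∑[ w < n ] 𝟙 (lookup K x ∧ adj G w x)
    degree-from-K x with lookup K x
    ... | false = sym (sum-replicate-zero n)
    ... | true  = trans (+-identityʳ _)
                        (trans (degree≡sum G x) (sum-cong (λ w → cong 𝟙 (Graph.sym G x w))))

  -- Every K-neighbour b ≠ a of w is adjacent to a, so w is a common neighbour of the edge ab of K.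
  nbrsInK-pred≤ : ∀ w a → 𝟙 (lookup K a ∧ adj G w a) * (nbrsInK w ∸ 1) ≤
                          ∑[ b < n ] (edgeIn a b * 𝟙 (adj G a w ∧ adj G b w))
  nbrsInK-pred≤ w a with lookup K a ∧ adj G w a in a∈K∧w~a
  ... | false = z≤n
  ... | true  = ≤-trans (≤-reflexive (+-identityʳ _))
                        (m≤n+o⇒m∸n≤o (nbrsInK w) 1
                                     (≤-trans (sum-mono-≤ split) (≤-reflexive (sum-𝟙-≟-+ a _))))
    where
    a∈K : lookup K a ≡ true
    a∈K = ∧-conicalˡ _ _ a∈K∧w~a
    a~w : adj G a w ≡ true
    a~w = trans (Graph.sym G a w) (∧-conicalʳ _ _ a∈K∧w~a)
    split : ∀ b → 𝟙 (lookup K b ∧ adj G w b) ≤ 𝟙 ⌊ b ≟ a ⌋ + edgeIn a b * 𝟙 (adj G a w ∧ adj G b w)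
    split b with b ≟ a
    ... | yes refl = ≤-trans (𝟙≤1 _) (m≤m+n 1 _)
    ... | no  b≢a  with lookup K b in b∈K | adj G w b in w~b
    ...   | false | _     = z≤n
    ...   | true  | false = z≤n
    ...   | true  | true
      rewrite a∈K | K-complete a∈K b∈K (b≢a ∘ sym) | a~w | trans (Graph.sym G b w) w~b = ≤-refl

  ∑nbrsInK*pred≤codegreeSum : ∑[ w < n ] (nbrsInK w * (nbrsInK w ∸ 1)) ≤ codegreeSum
  ∑nbrsInK*pred≤codegreeSum = begin
    ∑[ w < n ] (nbrsInK w * (nbrsInK w ∸ 1))
      ≡⟨ sum-cong (λ w → *-distribʳ-sum (nbrsInK w ∸ 1) (λ a → 𝟙 (lookup K a ∧ adj G w a))) ⟩
    ∑[ w < n ] ∑[ a < n ] (𝟙 (lookup K a ∧ adj G w a) * (nbrsInK w ∸ 1))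
      ≤⟨ sum-mono-≤ (λ w → sum-mono-≤ (nbrsInK-pred≤ w)) ⟩
    ∑[ w < n ] ∑[ a < n ] ∑[ b < n ] (edgeIn a b * 𝟙 (adj G a w ∧ adj G b w))
      ≡⟨ ∑-comm (λ w a → ∑[ b < n ] (edgeIn a b * 𝟙 (adj G a w ∧ adj G b w))) ⟩
    ∑[ a < n ] ∑[ w < n ] ∑[ b < n ] (edgeIn a b * 𝟙 (adj G a w ∧ adj G b w))
      ≡⟨ sum-cong (λ a → ∑-comm (λ w b → edgeIn a b * 𝟙 (adj G a w ∧ adj G b w))) ⟩
    ∑[ a < n ] ∑[ b < n ] ∑[ w < n ] (edgeIn a b * 𝟙 (adj G a w ∧ adj G b w))
      ≡⟨ sum-cong (λ a → sum-cong (λ b → sym (by-codegree a b))) ⟩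
    codegreeSum
      ∎
    where
    open ≤-Reasoning
    by-codegree : ∀ a b → edgeIn a b * codegree G a b ≡ ∑[ w < n ] (edgeIn a b * 𝟙 (adj G a w ∧ adj G b w))
    by-codegree a b = trans (cong (edgeIn a b *_) (codegree≡sum G a b))
                            (*-distribˡ-sum (edgeIn a b) (λ w → 𝟙 (adj G a w ∧ adj G b w)))

  codegreeSum-lower : ∀ q → 2 * q * (∣ K ∣ * minDegree G) ≤ codegreeSum + n * (suc q * q)
  codegreeSum-lower q = begin
    2 * q * (∣ K ∣ * minDegree G)
      ≤⟨ *-monoʳ-≤ (2 * q) ∣K∣*δ≤∑nbrsInK ⟩
    2 * q * ∑[ w < n ] nbrsInK w
      ≡⟨ *-distribˡ-sum (2 * q) nbrsInK ⟩
    ∑[ w < n ] (2 * q * nbrsInK w)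
      ≤⟨ sum-mono-≤ (λ w → quadratic-bound (nbrsInK w) q) ⟩
    ∑[ w < n ] (nbrsInK w * (nbrsInK w ∸ 1) + suc q * q)
      ≡⟨ ∑-distrib-+ (λ w → nbrsInK w * (nbrsInK w ∸ 1)) (λ _ → suc q * q) ⟩
    ∑[ w < n ] (nbrsInK w * (nbrsInK w ∸ 1)) + ∑[ w < n ] (suc q * q)
      ≤⟨ +-mono-≤ ∑nbrsInK*pred≤codegreeSum (≤-reflexive (sum-const n _)) ⟩
    codegreeSum + n * (suc q * q)
      ∎
    where open ≤-Reasoning

  ∑edgeIn-row : ∀ a → ∑[ b < n ] edgeIn a b ≡ 𝟙 (lookup K a) * (∣ K ∣ ∸ 1)
  ∑edgeIn-row a = row (lookup K a) refl
    where
    row : ∀ β → lookup K a ≡ β → ∑[ b < n ] edgeIn a b ≡ 𝟙 β * (∣ K ∣ ∸ 1)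
    row false a∉K =
      trans (sum-cong (λ b → cong (λ t → 𝟙 (t ∧ lookup K b ∧ adj G a b)) a∉K)) (sum-replicate-zero n)
    row true  a∈K = trans (sym (m+n∸n≡m _ 1))
                    (trans (cong (_∸ 1) (trans (+-comm _ 1) (sym ∣K∣≡))) (sym (+-identityʳ _)))
      where
      split : ∀ b → 𝟙 (lookup K b) ≡ 𝟙 ⌊ b ≟ a ⌋ + edgeIn a b
      split b with b ≟ a
      ... | yes refl rewrite a∈K | irrefl G b = refl
      ... | no  b≢a  rewrite a∈K with lookup K b in b∈K
      ...   | false = refl
      ...   | true  rewrite K-complete a∈K b∈K (b≢a ∘ sym) = refl
      ∣K∣≡ : ∣ K ∣ ≡ suc (∑[ b < n ] edgeIn a b)
      ∣K∣≡ = trans (∣S∣≡sum K) (trans (sum-cong split) (sum-𝟙-≟-+ a (edgeIn a)))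

  pairs≡ : pairs ≡ ∣ K ∣ * (∣ K ∣ ∸ 1)
  pairs≡ = begin
    ∑[ a < n ] ∑[ b < n ] edgeIn a b              ≡⟨ sum-cong ∑edgeIn-row ⟩
    ∑[ a < n ] (𝟙 (lookup K a) * (∣ K ∣ ∸ 1))     ≡⟨ *-distribʳ-sum (∣ K ∣ ∸ 1) (λ a → 𝟙 (lookup K a)) ⟨
    (∑[ a < n ] 𝟙 (lookup K a)) * (∣ K ∣ ∸ 1)     ≡⟨ cong (_* (∣ K ∣ ∸ 1)) (∣S∣≡sum K) ⟨
    ∣ K ∣ * (∣ K ∣ ∸ 1)                           ∎
    where open ≡-Reasoning

  -- The shift by one forces every maximiser of the weight to be an edge of K (once pairs > 0).
  weightedCodegree : Fin n → Fin n → ℕ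
  weightedCodegree a b = edgeIn a b * suc (codegree G a b)

  codegreeSum+pairs≤ : ∀ {a b} → (∀ x y → weightedCodegree x y ≤ weightedCodegree a b) →
                       codegreeSum + pairs ≤ pairs * weightedCodegree a b
  codegreeSum+pairs≤ {a} {b} maximal = begin
    codegreeSum + pairs
      ≡⟨ ∑-distrib-+ (λ x → ∑[ y < n ] (edgeIn x y * codegree G x y)) (λ x → ∑[ y < n ] edgeIn x y) ⟨
    ∑[ x < n ] (∑[ y < n ] (edgeIn x y * codegree G x y) + ∑[ y < n ] edgeIn x y)
      ≡⟨ sum-cong (λ x → trans (sym (∑-distrib-+ (λ y → edgeIn x y * codegree G x y) (edgeIn x)))
                               (sum-cong (λ y → trans (+-comm _ (edgeIn x y)) (sym (*-suc (edgeIn x y) _))))) ⟩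
    ∑[ x < n ] ∑[ y < n ] weightedCodegree x y
      ≤⟨ sum-mono-≤ (λ x → sum-mono-≤ (λ y → 𝟙-*-≤ (lookup K x ∧ lookup K y ∧ adj G x y) (maximal x y))) ⟩
    ∑[ x < n ] ∑[ y < n ] (edgeIn x y * weightedCodegree a b)
      ≡⟨ sum-cong (λ x → *-distribʳ-sum (weightedCodegree a b) (edgeIn x)) ⟨
    ∑[ x < n ] ((∑[ y < n ] edgeIn x y) * weightedCodegree a b)
      ≡⟨ *-distribʳ-sum (weightedCodegree a b) (λ x → ∑[ y < n ] edgeIn x y) ⟨
    pairs * weightedCodegree a b
      ∎
    where open ≤-Reasoning

  heaviest⇒edge : ∀ a b → 0 < pairs → codegreeSum + pairs ≤ pairs * weightedCodegree a b →
                  adj G a b ≡ true × codegreeSum ≤ pairs * codegree G a b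
  heaviest⇒edge a b 0<pairs = by-edgeIn (lookup K a ∧ lookup K b ∧ adj G a b) refl
    where
    c : ℕ
    c = codegree G a b
    by-edgeIn : ∀ β → (lookup K a ∧ lookup K b ∧ adj G a b) ≡ β →
                codegreeSum + pairs ≤ pairs * (𝟙 β * suc c) → adj G a b ≡ true × codegreeSum ≤ pairs * c
    by-edgeIn false _    bound =
      contradiction (≤-trans (m≤n+m pairs codegreeSum) (≤-trans bound (≤-reflexive (*-zeroʳ pairs)))) (<⇒≱ 0<pairs)
    by-edgeIn true  ab∈K bound =
      ∧-conicalʳ (lookup K b) _ (∧-conicalʳ (lookup K a) _ ab∈K) , +-cancelˡ-≤ pairs codegreeSum _ (begin
      pairs + codegreeSum    ≡⟨ +-comm pairs codegreeSum ⟩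
      codegreeSum + pairs    ≤⟨ bound ⟩
      pairs * (1 * suc c)    ≡⟨ cong (pairs *_) (*-identityˡ (suc c)) ⟩
      pairs * suc c          ≡⟨ *-suc pairs c ⟩
      pairs + pairs * c      ∎)
      where open ≤-Reasoning

  ∃-edge-with-codegreeSum≤ : 0 < pairs →
                             ∃₂ λ a b → adj G a b ≡ true × codegreeSum ≤ pairs * codegree G a b
  ∃-edge-with-codegreeSum≤ 0<pairs
    with v , _ ← sum-pos⇒∃ (λ a → ∑[ b < n ] edgeIn a b) 0<pairs
    with a , b , maximal ← ∃-maximum₂ weightedCodegree v
    = a , b , heaviest⇒edge a b 0<pairs (codegreeSum+pairs≤ maximal)

  ∃-edge-with-large-codegree : 2 ≤ ∣ K ∣ → ∀ q → ∃₂ λ a b → adj G a b ≡ true ×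
    2 * q * (∣ K ∣ * minDegree G) ≤ ∣ K ∣ * (∣ K ∣ ∸ 1) * codegree G a b + n * (suc q * q)
  ∃-edge-with-large-codegree 2≤∣K∣ q = large (∃-edge-with-codegreeSum≤ 0<pairs)
    where
    0<pairs : 0 < pairs
    0<pairs = subst (0 <_) (sym pairs≡) (≤-trans (s≤s z≤n) (*-mono-≤ 2≤∣K∣ (∸-monoˡ-≤ 1 2≤∣K∣)))
    large : (∃₂ λ a b → adj G a b ≡ true × codegreeSum ≤ pairs * codegree G a b) →
            ∃₂ λ a b → adj G a b ≡ true ×
              2 * q * (∣ K ∣ * minDegree G) ≤ ∣ K ∣ * (∣ K ∣ ∸ 1) * codegree G a b + n * (suc q * q)
    large (a , b , a~b , codegreeSum≤) = a , b , a~b , ≤-trans (codegreeSum-lower q)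
      (+-monoˡ-≤ (n * (suc q * q)) (subst (λ N → codegreeSum ≤ N * codegree G a b) pairs≡ codegreeSum≤))

risingBy : ℕ → ℕ → ℕ → ℕ
risingBy l g zero    = 1
risingBy l g (suc k) = (k * l + g) * risingBy l g k

-- The i-th factor m ∸ i·d of the falling product is at least ((k ∸ i)·l + g)·n / M.
risingBy-≤-fallingBy : ∀ {l g d M n} → d * M ≤ l * n → ∀ k m → (k * l + g) * n ≤ m * M →
                       risingBy l g (suc k) * n ^ suc k ≤ fallingBy d m (suc k) * M ^ suc k
risingBy-≤-fallingBy {l} {g} {d} {M} {n} dM≤ln zero m gn≤mM = begin
  (0 * l + g) * 1 * (n * 1)  ≡⟨ cong₂ _*_ (*-identityʳ (0 * l + g)) (*-identityʳ n) ⟩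
  (0 * l + g) * n            ≤⟨ gn≤mM ⟩
  m * M                      ≡⟨ cong₂ _*_ (*-identityʳ m) (*-identityʳ M) ⟨
  m * 1 * (M * 1)            ∎
  where open ≤-Reasoning
risingBy-≤-fallingBy {l} {g} {d} {M} {n} dM≤ln (suc k) m top≤mM = begin
  (suc k * l + g) * risingBy l g (suc k) * (n * n ^ suc k)
    ≡⟨ [m*n]*[o*p]≡[m*o]*[n*p] (suc k * l + g) (risingBy l g (suc k)) n (n ^ suc k) ⟩
  (suc k * l + g) * n * (risingBy l g (suc k) * n ^ suc k)
    ≤⟨ *-mono-≤ top≤mM (risingBy-≤-fallingBy dM≤ln k (m ∸ d) next≤) ⟩
  m * M * (fallingBy d (m ∸ d) (suc k) * M ^ suc k)
    ≡⟨ [m*n]*[o*p]≡[m*o]*[n*p] m M (fallingBy d (m ∸ d) (suc k)) (M ^ suc k) ⟩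
  m * fallingBy d (m ∸ d) (suc k) * (M * M ^ suc k)
    ∎
  where
  open ≤-Reasoning
  peel : ∀ k l g n → (k * l + g) * n + l * n ≡ (suc k * l + g) * n
  peel = solve-∀
  next≤ : (k * l + g) * n ≤ (m ∸ d) * M
  next≤ = begin
    (k * l + g) * n  ≤⟨ m+n≤o⇒m≤o∸n _ (≤-trans (≤-reflexive (peel k l g n)) top≤mM) ⟩
    m * M ∸ l * n    ≤⟨ ∸-monoʳ-≤ (m * M) dM≤ln ⟩
    m * M ∸ d * M    ≡⟨ *-distribʳ-∸ M m d ⟨
    (m ∸ d) * M      ∎

factorial-≤-risingBy : ∀ {l g b} → b ≤ l → ∀ k → k ! * b ^ k * g ≤ risingBy l g (suc k)
factorial-≤-risingBy {l} {g} {b} b≤l zero    = ≤-reflexive (base l g)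
  where
  base : ∀ l g → 1 * 1 * g ≡ (0 * l + g) * 1
  base = solve-∀
factorial-≤-risingBy {l} {g} {b} b≤l (suc k) = begin
  suc k * k ! * (b * b ^ k) * g           ≡⟨ regroup (suc k) (k !) b (b ^ k) g ⟩
  suc k * b * (k ! * b ^ k * g)           ≤⟨ *-mono-≤ (≤-trans (*-monoʳ-≤ (suc k) b≤l) (m≤m+n _ g))
                                                       (factorial-≤-risingBy b≤l k) ⟩
  (suc k * l + g) * risingBy l g (suc k)  ∎
  where
  open ≤-Reasoning
  regroup : ∀ s f b x g → s * f * (b * x) * g ≡ s * b * (f * x * g)
  regroup = solve-∀

^-distribʳ-* : ∀ a b k → (a * b) ^ k ≡ a ^ k * b ^ k
^-distribʳ-* a b zero    = refl
^-distribʳ-* a b (suc k) =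
  trans (cong (a * b *_) (^-distribʳ-* a b k)) ([m*n]*[o*p]≡[m*o]*[n*p] a b (a ^ k) (b ^ k))

-- With r = p + 2 and q = r − 1: B = r²(r² − 1) is the denominator of the degree hypothesis, which then
-- reads (n − δ)·M ≤ L·n, and g = q² + 1 is exactly what the codegree bound yields in c·M ≥ (p·L + g)·n
-- (constants-identity is an equality).
module Constants (p : ℕ) where

  r : ℕ
  r = 2 + p

  q : ℕ
  q = 1 + p

  B : ℕ
  B = r * r * (q * (r + 1))

  M : ℕ
  M = r * B

  L : ℕ
  L = B + r

  g : ℕ
  g = q * q + 1

  r*r∸1≡ : r * r ∸ 1 ≡ q * (r + 1)
  r*r∸1≡ = cong (_∸ 1) (square p)
    where
    square : ∀ p → (2 + p) * (2 + p) ≡ suc ((1 + p) * (2 + p + 1))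
    square = solve-∀

  nonNeighbours-bound : ∀ {n δ} → (q * r * (q * (r + 1)) ∸ 1) * n < δ * B → δ ≤ n →
                        (n ∸ δ) * M ≤ L * n
  nonNeighbours-bound {n} {δ} δ-large δ≤n = begin
    (n ∸ δ) * M                ≡⟨ x*[y*z]≡y*[x*z] (n ∸ δ) r B ⟩
    r * ((n ∸ δ) * B)          ≤⟨ *-monoʳ-≤ r DB≤ ⟩
    r * ((r * X + 1) * n)      ≡⟨ factor-L r X n ⟩
    L * n                      ∎
    where
    open ≤-Reasoning
    X : ℕ
    X = q * (r + 1)
    A : ℕ
    A = q * r * X
    B≡ : ∀ q X → suc q * suc q * X ≡ q * suc q * X + suc q * X
    B≡ = solve-∀
    regroup : ∀ n a y → n * (a + 1 + y) ≡ (y + 1) * n + a * n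
    regroup = solve-∀
    factor-L : ∀ r X n → r * ((r * X + 1) * n) ≡ (r * r * X + r) * n
    factor-L = solve-∀
    DB≤ : (n ∸ δ) * B ≤ (r * X + 1) * n
    DB≤ = +-cancelʳ-≤ ((A ∸ 1) * n) _ _ (begin
      (n ∸ δ) * B + (A ∸ 1) * n          ≤⟨ +-monoʳ-≤ ((n ∸ δ) * B) (<⇒≤ δ-large) ⟩
      (n ∸ δ) * B + δ * B                ≡⟨ *-distribʳ-+ B (n ∸ δ) δ ⟨
      (n ∸ δ + δ) * B                    ≡⟨ cong (_* B) (m∸n+n≡m δ≤n) ⟩
      n * B                              ≡⟨ cong (n *_) (B≡ q X) ⟩
      n * (A + r * X)                    ≡⟨ cong (λ a → n * (a + r * X)) (m∸n+n≡m {A} {1} (s≤s z≤n)) ⟨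
      n * (A ∸ 1 + 1 + r * X)            ≡⟨ regroup n (A ∸ 1) (r * X) ⟩
      (r * X + 1) * n + (A ∸ 1) * n      ∎)

  codegree-bound : ∀ {n δ c} → 2 * q * (suc r * δ) ≤ suc r * r * c + n * (suc q * q) →
                   (n ∸ δ) * M ≤ L * n → δ ≤ n → (p * L + g) * n ≤ c * M
  codegree-bound {n} {δ} {c} codegree-large D-small δ≤n = *-cancelˡ-≤ r (+-cancelʳ-≤ W _ _ (begin
    r * ((p * L + g) * n) + W
      ≡⟨ trans (collect r p L g q n) (cong (_* n) constants-identity) ⟩
    2 * q * M * n
      ≡⟨ cong (λ m → 2 * q * M * m) (m∸n+n≡m δ≤n) ⟨
    2 * q * M * (n ∸ δ + δ)
      ≡⟨ split-δ q (n ∸ δ) δ ⟩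
    2 * q * ((n ∸ δ) * M) + r * r * r * q * (2 * q * (suc r * δ))
      ≤⟨ +-mono-≤ (*-monoʳ-≤ (2 * q) D-small) (*-monoʳ-≤ (r * r * r * q) codegree-large) ⟩
    2 * q * (L * n) + r * r * r * q * (suc r * r * c + n * (suc q * q))
      ≡⟨ spread q L n c ⟩
    r * (c * M) + W
      ∎))
    where
    open ≤-Reasoning
    W : ℕ
    W = 2 * q * (L * n) + n * (q * q * (r * r * r * r))
    constants-identity : r * (p * L + g) + 2 * q * L + q * q * (r * r * r * r) ≡ 2 * q * M
    constants-identity = identity p
      where
      identity : ∀ p → let r = 2 + p ; q = 1 + p ; B = r * r * (q * (r + 1)) ; L = B + r in
                 r * (p * L + (q * q + 1)) + 2 * q * L + q * q * (r * r * r * r) ≡ 2 * q * (r * B)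
      identity = solve-∀
    collect : ∀ r p L g q n → r * ((p * L + g) * n) + (2 * q * (L * n) + n * (q * q * (r * r * r * r))) ≡
                              (r * (p * L + g) + 2 * q * L + q * q * (r * r * r * r)) * n
    collect = solve-∀
    split-δ : ∀ q D δ → let r = suc q ; M = r * (r * r * (q * (r + 1))) in
              2 * q * M * (D + δ) ≡ 2 * q * (D * M) + r * r * r * q * (2 * q * (suc r * δ))
    split-δ = solve-∀
    spread : ∀ q L n c → let r = suc q ; M = r * (r * r * (q * (r + 1))) in
             2 * q * (L * n) + r * r * r * q * (suc r * r * c + n * (suc q * q)) ≡
             r * (c * M) + (2 * q * (L * n) + n * (q * q * (r * r * r * r)))
    spread = solve-∀

  q*M<g*r^5 : q * M < g * r ^ 5
  q*M<g*r^5 = subst (q * M <_) (identity p) (m<m+n (q * M) (s≤s z≤n))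
    where
    identity : ∀ p → let r = 2 + p ; q = 1 + p ; M = r * (r * r * (q * (r + 1))) in
               q * M + (r * (r * (r * (r * (r * 1)))) + r * r * r * (q * q * (p * p + 3 * p + 1))) ≡
               (q * q + 1) * (r * (r * (r * (r * (r * 1)))))
    identity = solve-∀

  factorial-power-bound : q ! * M ^ q < risingBy L g q * r ^ (r + 3)
  factorial-power-bound = begin-strict
    q ! * (M * M ^ p)                     ≡⟨ cong (λ t → q ! * (M * t)) (^-distribʳ-* r B p) ⟩
    q * p ! * (M * (r ^ p * B ^ p))       ≡⟨ regroup q (p !) M (r ^ p) (B ^ p) ⟩
    p ! * B ^ p * (q * M * r ^ p)
      <⟨ *-monoʳ-< (p ! * B ^ p) {{m*n≢0 (p !) (B ^ p) {{p !≢0}} {{m^n≢0 B p {{B≢0}}}}}}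
                   (*-monoˡ-< (r ^ p) {{m^n≢0 r p}} q*M<g*r^5) ⟩
    p ! * B ^ p * (g * r ^ 5 * r ^ p)
      ≡⟨ x*[y*z]≡[x*y]*z (p ! * B ^ p) g (r ^ 5) (r ^ p) ⟩
    p ! * B ^ p * g * (r ^ 5 * r ^ p)
      ≤⟨ *-mono-≤ (factorial-≤-risingBy (m≤m+n B r) p)
                  (≤-reflexive (trans (sym (^-distribˡ-+-* r 5 p)) (cong (r ^_) (5+p≡ p)))) ⟩
    risingBy L g q * r ^ (r + 3)
      ∎
    where
    open ≤-Reasoning
    B≢0 : NonZero B
    B≢0 = >-nonZero (s≤s z≤n)
    regroup : ∀ s f m x y → s * f * (m * (x * y)) ≡ f * y * (s * m * x)
    regroup = solve-∀
    x*[y*z]≡[x*y]*z : ∀ x g y z → x * (g * y * z) ≡ x * g * (y * z)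
    x*[y*z]≡[x*y]*z = solve-∀
    5+p≡ : ∀ p → 5 + p ≡ 2 + p + 3
    5+p≡ = solve-∀

  js2k2-large-at-edge : ∀ {n} (G : Graph n) {a b} → adj G a b ≡ true → 0 < n → (n ∸ minDegree G) * M ≤ L * n →
                        (p * L + g) * n ≤ codegree G a b * M → n ^ q < js2k2 G (suc r) * r ^ (r + 3)
  js2k2-large-at-edge {n} G {a} {b} a~b 0<n D-small codegree-large =
    *-cancelʳ-< (q ! * M ^ q) (n ^ q) (js2k2 G (suc r) * r ^ (r + 3)) (begin-strict
      n ^ q * (q ! * M ^ q)
        <⟨ *-monoʳ-< (n ^ q) {{m^n≢0 n q {{>-nonZero 0<n}}}} factorial-power-bound ⟩
      n ^ q * (risingBy L g q * r ^ (r + 3))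
        ≡⟨ x*[y*z]≡y*[x*z] (n ^ q) (risingBy L g q) (r ^ (r + 3)) ⟩
      risingBy L g q * (n ^ q * r ^ (r + 3))
        ≡⟨ *-assoc (risingBy L g q) (n ^ q) (r ^ (r + 3)) ⟨
      risingBy L g q * n ^ q * r ^ (r + 3)
        ≤⟨ *-monoˡ-≤ (r ^ (r + 3)) cliques ⟩
      q ! * js2k2 G (suc r) * M ^ q * r ^ (r + 3)
        ≡⟨ regroup (q !) (js2k2 G (suc r)) (M ^ q) (r ^ (r + 3)) ⟩
      js2k2 G (suc r) * r ^ (r + 3) * (q ! * M ^ q)
        ∎)
    where
    open ≤-Reasoning
    regroup : ∀ f j m s → f * j * m * s ≡ j * s * (f * m)
    regroup = solve-∀
    cliques : risingBy L g q * n ^ q ≤ q ! * js2k2 G (suc r) * M ^ q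
    cliques = begin
      risingBy L g q * n ^ q
        ≤⟨ risingBy-≤-fallingBy D-small p (codegree G a b) codegree-large ⟩
      fallingBy (n ∸ minDegree G) (codegree G a b) q * M ^ q
        ≤⟨ *-monoˡ-≤ (M ^ q) (fallingBy-≤-cliquesWithin G q (nbhd G a ∩ nbhd G b)) ⟩
      q ! * cliquesWithin G q (nbhd G a ∩ nbhd G b) * M ^ q
        ≤⟨ *-monoˡ-≤ (M ^ q) (*-monoʳ-≤ (q !) (≤-trans (cliquesWithin-∩-nbhd≤cliquesThrough G q a~b)
                                                         (cliquesThrough≤js2k2 G (suc r) a~b))) ⟩
      q ! * js2k2 G (suc r) * M ^ q
        ∎

  js2k2-large : ∀ {n} (G : Graph n) K → IsComplete G K → ∣ K ∣ ≡ suc r → (n ∸ minDegree G) * M ≤ L * n →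
                n ^ q < js2k2 G (suc r) * r ^ (r + 3)
  js2k2-large {n} G K K-complete ∣K∣≡ D-small =
    at-edge (CodegreeInClique.∃-edge-with-large-codegree G K K-complete
               (subst (2 ≤_) (sym ∣K∣≡) (s≤s (s≤s z≤n))) q)
    where
    0<n : 0 < n
    0<n = ≤-trans (s≤s z≤n) (subst (_≤ n) ∣K∣≡ (∣p∣≤n K))
    at-edge : (∃₂ λ a b → adj G a b ≡ true ×
                 2 * q * (∣ K ∣ * minDegree G) ≤ ∣ K ∣ * (∣ K ∣ ∸ 1) * codegree G a b + n * (suc q * q)) →
              n ^ q < js2k2 G (suc r) * r ^ (r + 3)
    at-edge (a , b , a~b , codegree-large) =
      js2k2-large-at-edge G a~b 0<n D-small
        (codegree-bound {n} {minDegree G} {codegree G a b}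
          (subst (λ k → 2 * q * (k * minDegree G) ≤ k * (k ∸ 1) * codegree G a b + n * (suc q * q))
                 ∣K∣≡ codegree-large)
          D-small (minDegree≤n G))

-- The argument only needs r ≥ 2.
lemma5 : (r n : ℕ) → 3 ≤ r → (G : Graph n) → ContainsK G (r + 1) →
    ((r ∸ 1) * r * (r * r ∸ 1) ∸ 1) * n < minDegree G * (r * r * (r * r ∸ 1)) →
    n ^ (r ∸ 1) < js2k2 G (r + 1) * r ^ (r + 3)
lemma5 (suc (suc p)) n (s≤s (s≤s _)) G (K , K-clique) δ-large =
  subst (λ k → n ^ q < js2k2 G k * r ^ (r + 3)) (+-comm 1 r)
        (js2k2-large G K K-complete (trans ∣K∣≡r+1 (+-comm r 1)) (nonNeighbours-bound δ-large′ (minDegree≤n G)))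
  where
  open Constants p
  K-complete : IsComplete G K
  K-complete = proj₁ (isCliqueB⁻ G K K-clique)
  ∣K∣≡r+1 : ∣ K ∣ ≡ r + 1
  ∣K∣≡r+1 = proj₂ (isCliqueB⁻ G K K-clique)
  δ-large′ : (q * r * (q * (r + 1)) ∸ 1) * n < minDegree G * B
  δ-large′ = subst (λ x → (q * r * x ∸ 1) * n < minDegree G * (r * r * x)) r*r∸1≡ δ-large
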